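{- Let $(a_n)_{n\ge 0}$ be a sequence of real numbers with $a_0=1$, let $F(t)=1+\sum_{n\ge1}a_n\frac{t^n}{n!}$, and for every real $\alpha$ define polynomials $f_n^{(\alpha)}(x)$ by $\sum_{n\ge0}f_n^{(\alpha)}(x)\frac{t^n}{n!}=(F(t))^{\alpha}e^{xt}$; write $f_n=f_n^{(1)}$. Let $n$ be a non-negative integer, let $(u_k)$, $(v_k)$ be sequences of real numbers, and let $U(n,k)$, $V(n,k)$ ($0\le k\le n$) be real numbers such that $$\sum_{k=0}^{n}U(n,k)f_k(x+u_k)=\sum_{k=0}^{n}V(n,k)(x+v_k)^k\quad\text{for all real }x.$$ Then for every real $\alpha$ and every real $x$, $$\sum_{k=0}^{n}U(n,k)f_k^{(\alpha)}(x+u_k)=\sum_{k=0}^{n}V(n,k)f_k^{(\alpha-1)}(x+v_k),$$ and $$\alpha\sum_{k=0}^{n}U(n,k)\Big(f_{k+1}^{(\alpha+1)}(x+u_k)-u_kf_k^{(\alpha+1)}(x+u_k)\Big)=\sum_{k=0}^{n}V(n,k)\Big((\alpha+1)f_{k+1}^{(\alpha)}(x+v_k)-\big(x+(\alpha+1)v_k\big)f_k^{(\alpha)}(x+v_k)\Big).$$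
   Context: Here $(F(t))^\alpha=\exp(\alpha\log F(t))$ as a formal power series (well defined since $F(0)=1$); note $f_n^{(0)}(x)=x^n$. -}

module Defs where

open import Level using (Level)
open import Data.Nat using (ℕ; zero; suc; _∸_)
open import Data.Nat.Combinatorics using (_C_)
open import Algebra.Bundles using (CommutativeRing)
open import Data.Product using (∃)
open import Relation.Nullary using (¬_)

-- Everything is over an arbitrary commutative ring R (the paper: R = ℝ).
module Over {c ℓ : Level} (R : CommutativeRing c ℓ) where
  open CommutativeRing R

  fromℕ : ℕ → Carrier
  fromℕ zero    = 0#
  fromℕ (suc n) = 1# + fromℕ n

  pow : Carrier → ℕ → Carrier
  pow x zero    = 1#
  pow x (suc n) = x * pow x n

  sum≤ : ℕ → (ℕ → Carrier) → Carrier
  sum≤ zero    f = f 0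
  sum≤ (suc n) f = sum≤ n f + f (suc n)

  sum< : ℕ → (ℕ → Carrier) → Carrier
  sum< zero    f = 0#
  sum< (suc n) f = sum< n f + f n

  binom : ℕ → ℕ → Carrier
  binom n k = fromℕ (n C k)

  record IsCharZeroField : Set (c Level.⊔ ℓ) where
    field
      charZero : ∀ n → ¬ (fromℕ (suc n) ≈ 0#)
      inverse  : ∀ x → ¬ (x ≈ 0#) → ∃ λ y → x * y ≈ 1#

  -- Exponential generating functions: a sequence s : ℕ → R represents the
  -- formal power series ∑ s n tⁿ/n!.  Product of EGFs is the binomial
  -- convolution, and the derivative is the shift s ↦ s ∘ suc.

  -- Coefficients of log F, where F(t) = 1 + ∑_{n≥1} a n tⁿ/n!.
  -- log F = L is the unique series with L(0) = 0 and L' · F = F',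
  -- i.e.  ∑_{k=0}^{n} C(n,k) l(k+1) a(n-k) = a(n+1) (with a 0 = 1), i.e.
  --   l(n+1) = a(n+1) - ∑_{k<n} C(n,k) a(n-k) l(k+1).
  -- Implemented with a fuel argument (fuel ≥ index suffices).
  logAux : (ℕ → Carrier) → ℕ → ℕ → Carrier
  logAux a zero       _       = 0#
  logAux a (suc fuel) zero    = 0#
  logAux a (suc fuel) (suc n) =
    a (suc n) - sum< n (λ k → binom n k * a (n ∸ k) * logAux a fuel (suc k))

  logCoeff : (ℕ → Carrier) → ℕ → Carrier
  logCoeff a n = logAux a n n

  -- Coefficients of exp(G) for a series G with G(0) = 0 (given by coefficients g):
  -- E = exp G is the unique series with E(0) = 1 and E' = G' · E, i.e.
  --   e(n+1) = ∑_{k=0}^{n} C(n,k) g(k+1) e(n-k).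
  expAux : (ℕ → Carrier) → ℕ → ℕ → Carrier
  expAux g zero       _       = 1#
  expAux g (suc fuel) zero    = 1#
  expAux g (suc fuel) (suc n) =
    sum≤ n (λ k → binom n k * g (suc k) * expAux g fuel (n ∸ k))

  expCoeff : (ℕ → Carrier) → ℕ → Carrier
  expCoeff g n = expAux g n n

  -- Coefficients of (F(t))^α = exp(α log F(t)).
  powCoeff : (ℕ → Carrier) → Carrier → ℕ → Carrier
  powCoeff a α = expCoeff (λ n → α * logCoeff a n)

  -- f_n^{(α)}(x) : ∑_n f_n^{(α)}(x) tⁿ/n! = F(t)^α e^{xt}, i.e.
  -- f_n^{(α)}(x) = ∑_{k=0}^{n} C(n,k) [F^α]_k x^{n-k}.
  fpoly : (ℕ → Carrier) → Carrier → ℕ → Carrier → Carrier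
  fpoly a α n x = sum≤ n (λ k → binom n k * powCoeff a α k * pow x (n ∸ k))

-- Read sequences as exponential generating functions, so that the binomial
-- convolution ⊛ is the product of series, D is d/dt and pow x is e^{xt}; the
-- polynomials are then f_k^{(α)}(z) = [tᵏ/k!] E_α e^{zt} with E_α = F^α.
-- For fixed x, both sides of the hypothesis are linear functionals of a
-- series s, namely Φ_U(s) = ∑ U_k [tᵏ/k!] s e^{(x+u_k)t} at s = E_1 and Φ_V
-- (the same with V, v) at s = 1.  Replacing x by x + y multiplies s by e^{yt},
-- so the two functionals s ↦ Φ_U(E_1 s) and s ↦ Φ_V(s) agree on every e^{yt}.
-- Both only read the first n + 1 coefficients of s, so by the identity theorem
-- for polynomials over an infinite field they agree on every s.  Taking
-- s = E_{α-1} gives the first identity; the second follows from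
-- E_{α+1} = E_1 E_α and the derivative rule E_β' = β (log F)' E_β, applied
-- with s = E_α and s = D E_α.
module Submission where

open import Defs
open import Level using (Level)
open import Data.Nat as ℕ using (ℕ; zero; suc; _∸_; _≤_; _<_; z≤n; s≤s)
import Data.Nat.Properties as ℕ
open import Data.Nat.Combinatorics
  using (_C_; k>n⇒nCk≡0; nCk+nC[k+1]≡[n+1]C[k+1]; nCn≡1; nC1≡n; nCk≡nC[n∸k])
open import Data.Product using (_×_; _,_)
open import Data.Sum using (inj₁; inj₂)
open import Algebra.Bundles using (CommutativeRing)
import Relation.Binary.PropositionalEquality as ≡

module EGF {c ℓ : Level} (R : CommutativeRing c ℓ) where
  open CommutativeRing R
  open Over R
  open import Relation.Binary.Reasoning.Setoid setoid
  open import Algebra.Solver.Ring.NaturalCoefficients.Default commutativeSemiring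
    using (solve; _:=_; _:+_; _:*_; con)
  open import Algebra.Properties.Ring ring using (x[y-z]≈xy-xz)
  open import Algebra.Properties.AbelianGroup +-abelianGroup using (⁻¹-∙-comm)
  open import Algebra.Properties.Group +-group
    using (x∙y⁻¹≈ε⇒x≈y; x≈y⇒x∙y⁻¹≈ε; //-rightDividesˡ; //-rightDividesʳ)

  Seq : Set c
  Seq = ℕ → Carrier

  infix 4 _≐_
  _≐_ : Seq → Seq → Set ℓ
  A ≐ B = ∀ n → A n ≈ B n

  -- Finite sums

  sum≤-cong-≤ : ∀ n {f g : Seq} → (∀ k → k ≤ n → f k ≈ g k) → sum≤ n f ≈ sum≤ n g
  sum≤-cong-≤ zero    f≈g = f≈g 0 z≤n
  sum≤-cong-≤ (suc n) f≈g =
    +-cong (sum≤-cong-≤ n (λ k k≤n → f≈g k (ℕ.m≤n⇒m≤1+n k≤n))) (f≈g (suc n) ℕ.≤-refl)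

  sum≤-cong : ∀ n {f g : Seq} → f ≐ g → sum≤ n f ≈ sum≤ n g
  sum≤-cong n f≈g = sum≤-cong-≤ n (λ k _ → f≈g k)

  sum≤-+ : ∀ n (f g : Seq) → sum≤ n (λ k → f k + g k) ≈ sum≤ n f + sum≤ n g
  sum≤-+ zero    f g = refl
  sum≤-+ (suc n) f g = trans (+-congʳ (sum≤-+ n f g))
    (solve 4 (λ a b x y → (a :+ b) :+ (x :+ y) := (a :+ x) :+ (b :+ y)) refl _ _ _ _)

  sum≤-*ˡ : ∀ n a (f : Seq) → sum≤ n (λ k → a * f k) ≈ a * sum≤ n f
  sum≤-*ˡ zero    a f = refl
  sum≤-*ˡ (suc n) a f = trans (+-congʳ (sum≤-*ˡ n a f)) (sym (distribˡ a _ _))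

  sum≤-neg : ∀ n (f : Seq) → sum≤ n (λ k → - f k) ≈ - sum≤ n f
  sum≤-neg zero    f = refl
  sum≤-neg (suc n) f = trans (+-congʳ (sum≤-neg n f)) (⁻¹-∙-comm _ _)

  sum≤-- : ∀ n (f g : Seq) → sum≤ n (λ k → f k - g k) ≈ sum≤ n f - sum≤ n g
  sum≤-- n f g = trans (sum≤-+ n f (λ k → - g k)) (+-congˡ (sum≤-neg n g))

  sum≤-lincomb : ∀ n a b (c f g : Seq) →
    sum≤ n (λ k → c k * (a * f k + b * g k))
      ≈ a * sum≤ n (λ k → c k * f k) + b * sum≤ n (λ k → c k * g k)
  sum≤-lincomb n a b c f g = begin
    sum≤ n (λ k → c k * (a * f k + b * g k))
      ≈⟨ sum≤-cong n (λ k → solve 5 (λ c a f b g → c :* (a :* f :+ b :* g)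
                                                := a :* (c :* f) :+ b :* (c :* g))
                                     refl (c k) a (f k) b (g k)) ⟩
    sum≤ n (λ k → a * (c k * f k) + b * (c k * g k))
      ≈⟨ sum≤-+ n _ _ ⟩
    sum≤ n (λ k → a * (c k * f k)) + sum≤ n (λ k → b * (c k * g k))
      ≈⟨ +-cong (sum≤-*ˡ n a _) (sum≤-*ˡ n b _) ⟩
    a * sum≤ n (λ k → c k * f k) + b * sum≤ n (λ k → c k * g k) ∎

  sum≤-suc : ∀ n (f : Seq) → sum≤ (suc n) f ≈ f 0 + sum≤ n (λ k → f (suc k))
  sum≤-suc zero    f = refl
  sum≤-suc (suc n) f = trans (+-congʳ (sum≤-suc n f)) (+-assoc _ _ _)

  sum≤-swap : ∀ n m (f : ℕ → ℕ → Carrier) →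
    sum≤ n (λ i → sum≤ m (f i)) ≈ sum≤ m (λ j → sum≤ n (λ i → f i j))
  sum≤-swap zero    m f = refl
  sum≤-swap (suc n) m f =
    trans (+-congʳ (sum≤-swap n m f)) (sym (sum≤-+ m _ (f (suc n))))

  sum≤-zero : ∀ n (f : Seq) → (∀ k → k ≤ n → f k ≈ 0#) → sum≤ n f ≈ 0#
  sum≤-zero zero    f f≈0 = f≈0 0 z≤n
  sum≤-zero (suc n) f f≈0 =
    trans (+-cong (sum≤-zero n f (λ k k≤n → f≈0 k (ℕ.m≤n⇒m≤1+n k≤n))) (f≈0 (suc n) ℕ.≤-refl))
          (+-identityʳ 0#)

  sum≤-extend : ∀ {m} n (f : Seq) → m ≤ n → (∀ k → m < k → k ≤ n → f k ≈ 0#) →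
    sum≤ n f ≈ sum≤ m f
  sum≤-extend zero    f z≤n _ = refl
  sum≤-extend (suc n) f m≤1+n f≈0 with ℕ.m≤n⇒m<n∨m≡n m≤1+n
  ... | inj₂ ≡.refl    = refl
  ... | inj₁ (s≤s m≤n) = begin
    sum≤ n f + f (suc n)
      ≈⟨ +-cong (sum≤-extend n f m≤n (λ k m<k k≤n → f≈0 k m<k (ℕ.m≤n⇒m≤1+n k≤n)))
                (f≈0 (suc n) (s≤s m≤n) ℕ.≤-refl) ⟩
    _ + 0#  ≈⟨ +-identityʳ _ ⟩
    _       ∎

  sum≤-last : ∀ n (f : Seq) → (∀ k → k < n → f k ≈ 0#) → sum≤ n f ≈ f n
  sum≤-last zero    f _   = refl
  sum≤-last (suc n) f f≈0 =
    trans (+-congʳ (sum≤-zero n f (λ k k≤n → f≈0 k (s≤s k≤n)))) (+-identityˡ _)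

  sum≤-drop-last : ∀ n (f : Seq) → f (suc n) ≈ 0# → sum≤ (suc n) f ≈ sum≤ n f
  sum≤-drop-last n f f≈0 = trans (+-congˡ f≈0) (+-identityʳ _)

  fromℕ-+ : ∀ m n → fromℕ (m ℕ.+ n) ≈ fromℕ m + fromℕ n
  fromℕ-+ zero    n = sym (+-identityˡ _)
  fromℕ-+ (suc m) n = trans (+-congˡ (fromℕ-+ m n)) (sym (+-assoc _ _ _))

  fromℕ-1 : fromℕ 1 ≈ 1#
  fromℕ-1 = +-identityʳ 1#

  binom-n0 : ∀ n → binom n 0 ≈ 1#
  binom-n0 n = fromℕ-1

  binom-nn : ∀ n → binom n n ≈ 1#
  binom-nn n = trans (reflexive (≡.cong fromℕ (nCn≡1 n))) fromℕ-1

  binom-[1+n]n : ∀ n → binom (suc n) n ≈ fromℕ (suc n)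
  binom-[1+n]n n = reflexive (≡.cong fromℕ (≡.trans (nCk≡nC[n∸k] (ℕ.n≤1+n n))
    (≡.trans (≡.cong (suc n C_) (ℕ.m+n∸n≡m 1 n)) (nC1≡n (suc n)))))

  binom-> : ∀ {n k} → n < k → binom n k ≈ 0#
  binom-> n<k = reflexive (≡.cong fromℕ (k>n⇒nCk≡0 n<k))

  binom-pascal : ∀ n k → binom (suc n) (suc k) ≈ binom n k + binom n (suc k)
  binom-pascal n k = trans (reflexive (≡.cong fromℕ (≡.sym (nCk+nC[k+1]≡[n+1]C[k+1] n k))))
                           (fromℕ-+ (n C k) (n C suc k))

  pow-1 : ∀ n → pow 1# n ≈ 1#
  pow-1 zero    = refl
  pow-1 (suc n) = trans (*-identityˡ _) (pow-1 n)

  pow-cong : ∀ {x y} n → x ≈ y → pow x n ≈ pow y n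
  pow-cong zero    x≈y = refl
  pow-cong (suc n) x≈y = *-cong x≈y (pow-cong n x≈y)

  -- Exponential generating functions

  infixl 7 _⊛_
  _⊛_ : Seq → Seq → Seq
  (A ⊛ B) n = sum≤ n (λ k → binom n k * A k * B (n ∸ k))

  D : Seq → Seq
  D A n = A (suc n)

  infixr 8 _·_
  _·_ : Carrier → Seq → Seq
  (a · A) n = a * A n

  infixl 6 _⊕_
  _⊕_ : Seq → Seq → Seq
  (A ⊕ B) n = A n + B n

  δ : Seq
  δ zero    = 1#
  δ (suc _) = 0#

  ⊛-congˡ : ∀ {A A′} B → A ≐ A′ → A ⊛ B ≐ A′ ⊛ B
  ⊛-congˡ B A≐A′ n = sum≤-cong n (λ k → *-congʳ (*-congˡ (A≐A′ k)))

  ⊛-congʳ-≤ : ∀ A {B B′} n → (∀ m → m ≤ n → B m ≈ B′ m) → (A ⊛ B) n ≈ (A ⊛ B′) n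
  ⊛-congʳ-≤ A n B≈B′ = sum≤-cong n (λ k → *-congˡ (B≈B′ (n ∸ k) (ℕ.m∸n≤m n k)))

  ⊛-congʳ : ∀ A {B B′} → B ≐ B′ → A ⊛ B ≐ A ⊛ B′
  ⊛-congʳ A B≐B′ n = ⊛-congʳ-≤ A n (λ m _ → B≐B′ m)

  ⊛-zero : ∀ A B → (A ⊛ B) 0 ≈ A 0 * B 0
  ⊛-zero A B = *-congʳ (trans (*-congʳ (binom-n0 0)) (*-identityˡ _))

  ⊛-D : ∀ A B → D (A ⊛ B) ≐ (D A ⊛ B) ⊕ (A ⊛ D B)
  ⊛-D A B n = begin
    (A ⊛ B) (suc n)
      ≈⟨ sum≤-suc n _ ⟩
    head + sum≤ n (λ k → binom (suc n) (suc k) * A (suc k) * B (n ∸ k))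
      ≈⟨ +-congˡ (sum≤-cong n (λ k → trans (*-congʳ (trans (*-congʳ (binom-pascal n k))
                                                              (distribʳ _ _ _)))
                                           (distribʳ _ _ _))) ⟩
    head + sum≤ n (λ k → binom n k * A (suc k) * B (n ∸ k) + binom n (suc k) * A (suc k) * B (n ∸ k))
      ≈⟨ +-congˡ (sum≤-+ n _ _) ⟩
    head + ((D A ⊛ B) n + middle)
      ≈⟨ solve 3 (λ a b c → a :+ (b :+ c) := b :+ (a :+ c)) refl head _ middle ⟩
    (D A ⊛ B) n + (head + middle)
      ≈⟨ +-congˡ (sym (sum≤-suc n (λ k → binom n k * A k * B (suc n ∸ k)))) ⟩
    (D A ⊛ B) n + (sum≤ n (λ k → binom n k * A k * B (suc n ∸ k)) + binom n (suc n) * A (suc n) * B (n ∸ n))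
      ≈⟨ +-congˡ (+-cong (sum≤-cong-≤ n (λ k k≤n → *-congˡ (reflexive (≡.cong B (ℕ.+-∸-assoc 1 k≤n)))))
                         (trans (*-congʳ (trans (*-congʳ (binom-> (ℕ.n<1+n n))) (zeroˡ _))) (zeroˡ _))) ⟩
    (D A ⊛ B) n + ((A ⊛ D B) n + 0#)
      ≈⟨ +-congˡ (+-identityʳ _) ⟩
    (D A ⊛ B) n + (A ⊛ D B) n ∎
    where
    head   = binom (suc n) 0 * A 0 * B (suc n)
    middle = sum≤ n (λ k → binom n (suc k) * A (suc k) * B (n ∸ k))

  ⊛-comm : ∀ A B → A ⊛ B ≐ B ⊛ A
  ⊛-comm A B zero    = trans (⊛-zero A B) (trans (*-comm _ _) (sym (⊛-zero B A)))
  ⊛-comm A B (suc n) = begin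
    (A ⊛ B) (suc n)               ≈⟨ ⊛-D A B n ⟩
    (D A ⊛ B) n + (A ⊛ D B) n     ≈⟨ +-cong (⊛-comm (D A) B n) (⊛-comm A (D B) n) ⟩
    (B ⊛ D A) n + (D B ⊛ A) n     ≈⟨ +-comm _ _ ⟩
    (D B ⊛ A) n + (B ⊛ D A) n     ≈⟨ ⊛-D B A n ⟨
    (B ⊛ A) (suc n)               ∎

  ⊛-distribʳ-⊕ : ∀ A B W → (A ⊕ B) ⊛ W ≐ (A ⊛ W) ⊕ (B ⊛ W)
  ⊛-distribʳ-⊕ A B W n =
    trans (sum≤-cong n (λ k → trans (*-congʳ (distribˡ _ _ _)) (distribʳ _ _ _))) (sum≤-+ n _ _)

  ⊛-distribˡ-⊕ : ∀ A B W → A ⊛ (B ⊕ W) ≐ (A ⊛ B) ⊕ (A ⊛ W)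
  ⊛-distribˡ-⊕ A B W n = trans (sum≤-cong n (λ k → distribˡ _ _ _)) (sum≤-+ n _ _)

  ⊛-·ˡ : ∀ a A B → (a · A) ⊛ B ≐ a · (A ⊛ B)
  ⊛-·ˡ a A B n = trans
    (sum≤-cong n (λ k → solve 4 (λ b a x y → b :* (a :* x) :* y := a :* (b :* x :* y)) refl _ a _ _))
    (sum≤-*ˡ n a _)

  ⊛-·ʳ : ∀ a A B → A ⊛ (a · B) ≐ a · (A ⊛ B)
  ⊛-·ʳ a A B n = trans
    (sum≤-cong n (λ k → solve 4 (λ b a x y → b :* x :* (a :* y) := a :* (b :* x :* y)) refl _ a _ _))
    (sum≤-*ˡ n a _)

  ⊛-assoc : ∀ A B W → (A ⊛ B) ⊛ W ≐ A ⊛ (B ⊛ W)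
  ⊛-assoc A B W zero = begin
    ((A ⊛ B) ⊛ W) 0     ≈⟨ ⊛-zero (A ⊛ B) W ⟩
    (A ⊛ B) 0 * W 0     ≈⟨ *-congʳ (⊛-zero A B) ⟩
    A 0 * B 0 * W 0     ≈⟨ *-assoc _ _ _ ⟩
    A 0 * (B 0 * W 0)   ≈⟨ *-congˡ (⊛-zero B W) ⟨
    A 0 * (B ⊛ W) 0     ≈⟨ ⊛-zero A (B ⊛ W) ⟨
    (A ⊛ (B ⊛ W)) 0     ∎
  ⊛-assoc A B W (suc n) = begin
    ((A ⊛ B) ⊛ W) (suc n)
      ≈⟨ ⊛-D (A ⊛ B) W n ⟩
    (D (A ⊛ B) ⊛ W) n + ((A ⊛ B) ⊛ D W) n
      ≈⟨ +-congʳ (trans (⊛-congˡ W (⊛-D A B) n) (⊛-distribʳ-⊕ (D A ⊛ B) (A ⊛ D B) W n)) ⟩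
    (((D A ⊛ B) ⊛ W) n + ((A ⊛ D B) ⊛ W) n) + ((A ⊛ B) ⊛ D W) n
      ≈⟨ +-cong (+-cong (⊛-assoc (D A) B W n) (⊛-assoc A (D B) W n)) (⊛-assoc A B (D W) n) ⟩
    ((D A ⊛ (B ⊛ W)) n + (A ⊛ (D B ⊛ W)) n) + (A ⊛ (B ⊛ D W)) n
      ≈⟨ +-assoc _ _ _ ⟩
    (D A ⊛ (B ⊛ W)) n + ((A ⊛ (D B ⊛ W)) n + (A ⊛ (B ⊛ D W)) n)
      ≈⟨ +-congˡ (sym (trans (⊛-congʳ A (⊛-D B W) n) (⊛-distribˡ-⊕ A (D B ⊛ W) (B ⊛ D W) n))) ⟩
    (D A ⊛ (B ⊛ W)) n + (A ⊛ D (B ⊛ W)) n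
      ≈⟨ ⊛-D A (B ⊛ W) n ⟨
    (A ⊛ (B ⊛ W)) (suc n) ∎

  ⊛-rotate : ∀ A B W → A ⊛ (B ⊛ W) ≐ B ⊛ (A ⊛ W)
  ⊛-rotate A B W n = begin
    (A ⊛ (B ⊛ W)) n   ≈⟨ ⊛-assoc A B W n ⟨
    ((A ⊛ B) ⊛ W) n   ≈⟨ ⊛-congˡ W (⊛-comm A B) n ⟩
    ((B ⊛ A) ⊛ W) n   ≈⟨ ⊛-assoc B A W n ⟩
    (B ⊛ (A ⊛ W)) n   ∎

  ⊛-identityˡ : ∀ A → δ ⊛ A ≐ A
  ⊛-identityˡ A zero    = trans (⊛-zero δ A) (*-identityˡ _)
  ⊛-identityˡ A (suc n) = begin
    (δ ⊛ A) (suc n)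
      ≈⟨ sum≤-suc n _ ⟩
    binom (suc n) 0 * 1# * A (suc n) + sum≤ n (λ k → binom (suc n) (suc k) * 0# * A (n ∸ k))
      ≈⟨ +-cong (trans (*-congʳ (trans (*-identityʳ _) (binom-n0 (suc n)))) (*-identityˡ _))
                (sum≤-zero n _ (λ k _ → trans (*-congʳ (zeroʳ _)) (zeroˡ _))) ⟩
    A (suc n) + 0#
      ≈⟨ +-identityʳ _ ⟩
    A (suc n) ∎

  ode-unique : ∀ H Y Z → Y 0 ≈ Z 0 → D Y ≐ H ⊛ Y → D Z ≐ H ⊛ Z → Y ≐ Z
  ode-unique H Y Z Y₀≈Z₀ Y′ Z′ n = agree n n ℕ.≤-refl
    where
    agree : ∀ n m → m ≤ n → Y m ≈ Z m
    agree n       zero    _         = Y₀≈Z₀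
    agree (suc n) (suc m) (s≤s m≤n) = begin
      Y (suc m)    ≈⟨ Y′ m ⟩
      (H ⊛ Y) m    ≈⟨ ⊛-congʳ-≤ H m (λ j j≤m → agree n j (ℕ.≤-trans j≤m m≤n)) ⟩
      (H ⊛ Z) m    ≈⟨ Z′ m ⟨
      Z (suc m)    ∎

  binomial-theorem : ∀ x y → pow x ⊛ pow y ≐ pow (x + y)
  binomial-theorem x y =
    ode-unique ((x + y) · δ) (pow x ⊛ pow y) (pow (x + y))
      (trans (⊛-zero (pow x) (pow y)) (*-identityˡ 1#)) derivative
      (λ n → sym (scaled-δ (pow (x + y)) n))
    where
    scaled-δ : ∀ A → ((x + y) · δ) ⊛ A ≐ (x + y) · A
    scaled-δ A n = trans (⊛-·ˡ (x + y) δ A n) (*-congˡ (⊛-identityˡ A n))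

    derivative : D (pow x ⊛ pow y) ≐ ((x + y) · δ) ⊛ (pow x ⊛ pow y)
    derivative n = begin
      (pow x ⊛ pow y) (suc n)
        ≈⟨ ⊛-D (pow x) (pow y) n ⟩
      ((x · pow x) ⊛ pow y) n + (pow x ⊛ (y · pow y)) n
        ≈⟨ +-cong (⊛-·ˡ x (pow x) (pow y) n) (⊛-·ʳ y (pow x) (pow y) n) ⟩
      x * (pow x ⊛ pow y) n + y * (pow x ⊛ pow y) n
        ≈⟨ distribʳ _ _ _ ⟨
      (x + y) * (pow x ⊛ pow y) n
        ≈⟨ scaled-δ (pow x ⊛ pow y) n ⟨
      (((x + y) · δ) ⊛ (pow x ⊛ pow y)) n ∎

  expAux-fuel : ∀ g f₁ f₂ m → m ≤ f₁ → m ≤ f₂ → expAux g f₁ m ≈ expAux g f₂ m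
  expAux-fuel g zero     zero     zero    _         _         = refl
  expAux-fuel g zero     (suc f₂) zero    _         _         = refl
  expAux-fuel g (suc f₁) zero     zero    _         _         = refl
  expAux-fuel g (suc f₁) (suc f₂) zero    _         _         = refl
  expAux-fuel g (suc f₁) (suc f₂) (suc m) (s≤s m≤f₁) (s≤s m≤f₂) = sum≤-cong m (λ k → *-congˡ
    (expAux-fuel g f₁ f₂ (m ∸ k) (ℕ.≤-trans (ℕ.m∸n≤m m k) m≤f₁) (ℕ.≤-trans (ℕ.m∸n≤m m k) m≤f₂)))

  expCoeff-D : ∀ g → D (expCoeff g) ≐ D g ⊛ expCoeff g
  expCoeff-D g n = sum≤-cong n (λ k → *-congˡ
    (expAux-fuel g n (n ∸ k) (n ∸ k) (ℕ.m∸n≤m n k) ℕ.≤-refl))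

  -- Linear functionals of a series

  Λ : ℕ → Seq → (ℕ → Seq) → Seq → Carrier
  Λ N c w s = sum≤ N (λ k → c k * (s ⊛ w k) k)

  Λ-coeff : ℕ → Seq → (ℕ → Seq) → Seq
  Λ-coeff N c w j = sum≤ N (λ k → c k * (binom k j * w k (k ∸ j)))

  Λ-cong : ∀ N c w {s s′} → s ≐ s′ → Λ N c w s ≈ Λ N c w s′
  Λ-cong N c w s≐s′ = sum≤-cong N (λ k → *-congˡ (⊛-congˡ (w k) s≐s′ k))

  Λ-· : ∀ N c w a s → Λ N c w (a · s) ≈ a * Λ N c w s
  Λ-· N c w a s = trans
    (sum≤-cong N (λ k → trans (*-congˡ (⊛-·ˡ a s (w k) k))
                              (solve 3 (λ c a x → c :* (a :* x) := a :* (c :* x)) refl (c k) a _)))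
    (sum≤-*ˡ N a _)

  Λ-⊛ : ∀ N c w A s → Λ N c w (A ⊛ s) ≈ Λ N c (λ k → A ⊛ w k) s
  Λ-⊛ N c w A s = sum≤-cong N (λ k → *-congˡ (trans (⊛-assoc A s (w k) k) (⊛-rotate A s (w k) k)))

  Λ-translate : ∀ N c (w : Seq) x y s →
    Λ N c (λ k → pow ((x + y) + w k)) s ≈ Λ N c (λ k → pow (x + w k)) (s ⊛ pow y)
  Λ-translate N c w x y s = sum≤-cong N (λ k → *-congˡ (begin
    (s ⊛ pow ((x + y) + w k)) k
      ≈⟨ ⊛-congʳ s (λ m → trans (pow-cong m (solve 3 (λ x y w → (x :+ y) :+ w := y :+ (x :+ w)) refl x y (w k)))
                                (sym (binomial-theorem y (x + w k) m))) k ⟩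
    (s ⊛ (pow y ⊛ pow (x + w k))) k
      ≈⟨ ⊛-assoc s (pow y) (pow (x + w k)) k ⟨
    ((s ⊛ pow y) ⊛ pow (x + w k)) k ∎))

  -- Λ only reads the first N + 1 coefficients of s, since binom k j = 0 for k < j.
  Λ-expand : ∀ N c w s → Λ N c w s ≈ sum≤ N (λ j → s j * Λ-coeff N c w j)
  Λ-expand N c w s = begin
    sum≤ N (λ k → c k * (s ⊛ w k) k)
      ≈⟨ sum≤-cong-≤ N (λ k k≤N → *-congˡ (sym (sum≤-extend N _ k≤N (λ j k<j _ →
           trans (*-congʳ (trans (*-congʳ (binom-> k<j)) (zeroˡ _))) (zeroˡ _))))) ⟩
    sum≤ N (λ k → c k * sum≤ N (λ j → binom k j * s j * w k (k ∸ j)))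
      ≈⟨ sum≤-cong N (λ k → sym (sum≤-*ˡ N (c k) _)) ⟩
    sum≤ N (λ k → sum≤ N (λ j → c k * (binom k j * s j * w k (k ∸ j))))
      ≈⟨ sum≤-swap N N _ ⟩
    sum≤ N (λ j → sum≤ N (λ k → c k * (binom k j * s j * w k (k ∸ j))))
      ≈⟨ sum≤-cong N (λ j → trans
           (sum≤-cong N (λ k → solve 4 (λ c b s w → c :* (b :* s :* w) := s :* (c :* (b :* w)))
                                       refl (c k) (binom k j) (s j) (w k (k ∸ j))))
           (sum≤-*ˡ N (s j) _)) ⟩
    sum≤ N (λ j → s j * Λ-coeff N c w j) ∎

  Λ-coeff-diagonal : ∀ N c w → Λ-coeff N c w N ≈ c N * w N 0
  Λ-coeff-diagonal N c w = begin
    Λ-coeff N c w N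
      ≈⟨ sum≤-last N _ (λ k k<N → trans (*-congˡ (trans (*-congʳ (binom-> k<N)) (zeroˡ _))) (zeroʳ _)) ⟩
    c N * (binom N N * w N (N ∸ N))
      ≈⟨ *-congˡ (trans (*-congʳ (binom-nn N)) (*-identityˡ _)) ⟩
    c N * w N (N ∸ N)
      ≈⟨ *-congˡ (reflexive (≡.cong (w N) (ℕ.n∸n≡0 N))) ⟩
    c N * w N 0 ∎

  module _ (F : IsCharZeroField) where
    open IsCharZeroField F

    fromℕ-suc-cancelʳ : ∀ m x → x * fromℕ (suc m) ≈ 0# → x ≈ 0#
    fromℕ-suc-cancelʳ m x x[1+m]≈0 with inverse (fromℕ (suc m)) (charZero m)
    ... | y , [1+m]y≈1 = begin
      x                       ≈⟨ *-identityʳ x ⟨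
      x * 1#                  ≈⟨ *-congˡ [1+m]y≈1 ⟨
      x * (fromℕ (suc m) * y) ≈⟨ *-assoc _ _ _ ⟨
      x * fromℕ (suc m) * y   ≈⟨ *-congʳ x[1+m]≈0 ⟩
      0# * y                  ≈⟨ zeroˡ y ⟩
      0#                      ∎

    coeffs-zero : ∀ n (c : Seq) → (∀ y → sum≤ n (λ i → pow y i * c i) ≈ 0#) → ∀ i → i ≤ n → c i ≈ 0#

    -- The difference p(y + 1) − p(y) has degree ≤ m and leading coefficient (m + 1) c_{m+1}.
    leading-coeff-zero : ∀ m (c : Seq) → (∀ y → sum≤ (suc m) (λ i → pow y i * c i) ≈ 0#) →
      c (suc m) ≈ 0#
    leading-coeff-zero m c p≈0 = fromℕ-suc-cancelʳ m (c (suc m)) (begin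
      c (suc m) * fromℕ (suc m)                 ≈⟨ //-rightDividesʳ (c m) _ ⟨
      (c (suc m) * fromℕ (suc m) + c m) - c m   ≈⟨ +-congʳ (trans (+-comm _ _) (sym Δ-m)) ⟩
      e m                                       ≈⟨ e-m ⟩
      0#                                        ∎)
      where
      Δ e : Seq
      Δ = Λ-coeff (suc m) c (λ _ → pow 1#)
      e i = Δ i - c i

      Δ-shift : ∀ y → sum≤ (suc m) (λ i → pow y i * Δ i) ≈ sum≤ (suc m) (λ j → pow (y + 1#) j * c j)
      Δ-shift y = begin
        sum≤ (suc m) (λ i → pow y i * Δ i)     ≈⟨ Λ-expand (suc m) c (λ _ → pow 1#) (pow y) ⟨
        Λ (suc m) c (λ _ → pow 1#) (pow y)
          ≈⟨ sum≤-cong (suc m) (λ j → trans (*-congˡ (binomial-theorem y 1# j)) (*-comm _ _)) ⟩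
        sum≤ (suc m) (λ j → pow (y + 1#) j * c j) ∎

      e-poly : ∀ y → sum≤ (suc m) (λ i → pow y i * e i) ≈ 0#
      e-poly y = begin
        sum≤ (suc m) (λ i → pow y i * e i)
          ≈⟨ sum≤-cong (suc m) (λ i → x[y-z]≈xy-xz (pow y i) (Δ i) (c i)) ⟩
        sum≤ (suc m) (λ i → pow y i * Δ i - pow y i * c i)
          ≈⟨ sum≤-- (suc m) _ _ ⟩
        sum≤ (suc m) (λ i → pow y i * Δ i) - sum≤ (suc m) (λ i → pow y i * c i)
          ≈⟨ +-cong (trans (Δ-shift y) (p≈0 (y + 1#))) (-‿cong (p≈0 y)) ⟩
        0# - 0#
          ≈⟨ -‿inverseʳ 0# ⟩
        0# ∎

      e-top : e (suc m) ≈ 0#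
      e-top = x≈y⇒x∙y⁻¹≈ε (trans (Λ-coeff-diagonal (suc m) c (λ _ → pow 1#)) (*-identityʳ _))

      e-m : e m ≈ 0#
      e-m = coeffs-zero m e
        (λ y → trans (sym (sum≤-drop-last m _ (trans (*-congˡ e-top) (zeroʳ _)))) (e-poly y)) m ℕ.≤-refl

      Δ-m : Δ m ≈ c m + c (suc m) * fromℕ (suc m)
      Δ-m = +-cong (trans (Λ-coeff-diagonal m c (λ _ → pow 1#)) (*-identityʳ _))
                   (*-congˡ (trans (*-cong (binom-[1+n]n m) (pow-1 (suc m ∸ m))) (*-identityʳ _)))

    coeffs-zero zero    c p≈0 zero z≤n = trans (sym (*-identityˡ (c 0))) (p≈0 0#)
    coeffs-zero (suc m) c p≈0 i i≤1+m with ℕ.m≤n⇒m<n∨m≡n i≤1+m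
    ... | inj₂ ≡.refl    = leading-coeff-zero m c p≈0
    ... | inj₁ (s≤s i≤m) = coeffs-zero m c (λ y → trans (sym (drop-top y)) (p≈0 y)) i i≤m
      where
      drop-top : ∀ y → sum≤ (suc m) (λ i → pow y i * c i) ≈ sum≤ m (λ i → pow y i * c i)
      drop-top y = sum≤-drop-last m _ (trans (*-congˡ (leading-coeff-zero m c p≈0)) (zeroʳ _))

    coeffs-unique : ∀ n (p q : Seq) →
      (∀ y → sum≤ n (λ i → pow y i * p i) ≈ sum≤ n (λ i → pow y i * q i)) →
      ∀ i → i ≤ n → p i ≈ q i
    coeffs-unique n p q p≈q i i≤n = x∙y⁻¹≈ε⇒x≈y (p i) (q i) (coeffs-zero n (λ i → p i - q i)
      (λ y → trans (sum≤-cong n (λ i → x[y-z]≈xy-xz (pow y i) (p i) (q i)))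
                   (trans (sum≤-- n _ _) (x≈y⇒x∙y⁻¹≈ε (p≈q y))))
      i i≤n)

    Λ-ext : ∀ N c w c′ w′ → (∀ y → Λ N c w (pow y) ≈ Λ N c′ w′ (pow y)) →
      ∀ s → Λ N c w s ≈ Λ N c′ w′ s
    Λ-ext N c w c′ w′ agree s = begin
      Λ N c w s                                 ≈⟨ Λ-expand N c w s ⟩
      sum≤ N (λ j → s j * Λ-coeff N c w j)
        ≈⟨ sum≤-cong-≤ N (λ j j≤N → *-congˡ (coeffs-unique N _ _ on-powers j j≤N)) ⟩
      sum≤ N (λ j → s j * Λ-coeff N c′ w′ j)    ≈⟨ Λ-expand N c′ w′ s ⟨
      Λ N c′ w′ s                               ∎
      where
      on-powers : ∀ y → sum≤ N (λ j → pow y j * Λ-coeff N c w j) ≈ sum≤ N (λ j → pow y j * Λ-coeff N c′ w′ j)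
      on-powers y = trans (sym (Λ-expand N c w (pow y))) (trans (agree y) (Λ-expand N c′ w′ (pow y)))

    Λ-transfer : ∀ N c d (u v : Seq) E →
      (∀ x → Λ N c (λ k → pow (x + u k)) E ≈ sum≤ N (λ k → d k * pow (x + v k) k)) →
      ∀ x s → Λ N c (λ k → pow (x + u k)) (E ⊛ s) ≈ Λ N d (λ k → pow (x + v k)) s
    Λ-transfer N c d u v E hyp x s = trans (Λ-⊛ N c (λ k → pow (x + u k)) E s)
      (Λ-ext N c (λ k → E ⊛ pow (x + u k)) d (λ k → pow (x + v k)) on-powers s)
      where
      on-powers : ∀ y → Λ N c (λ k → E ⊛ pow (x + u k)) (pow y) ≈ Λ N d (λ k → pow (x + v k)) (pow y)
      on-powers y = begin
        Λ N c (λ k → E ⊛ pow (x + u k)) (pow y)   ≈⟨ Λ-⊛ N c (λ k → pow (x + u k)) E (pow y) ⟨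
        Λ N c (λ k → pow (x + u k)) (E ⊛ pow y)   ≈⟨ Λ-translate N c u x y E ⟨
        Λ N c (λ k → pow ((x + y) + u k)) E       ≈⟨ hyp (x + y) ⟩
        sum≤ N (λ k → d k * pow ((x + y) + v k) k)
          ≈⟨ sum≤-cong N (λ k → *-congˡ (sym (⊛-identityˡ (pow ((x + y) + v k)) k))) ⟩
        Λ N d (λ k → pow ((x + y) + v k)) δ       ≈⟨ Λ-translate N d v x y δ ⟩
        Λ N d (λ k → pow (x + v k)) (δ ⊛ pow y)   ≈⟨ Λ-cong N d (λ k → pow (x + v k)) (⊛-identityˡ (pow y)) ⟩
        Λ N d (λ k → pow (x + v k)) (pow y)       ∎

  ⊛-pow-suc : ∀ s z k → (s ⊛ pow z) (suc k) ≈ (D s ⊛ pow z) k + z * (s ⊛ pow z) k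
  ⊛-pow-suc s z k = trans (⊛-D s (pow z) k) (+-congˡ (⊛-·ʳ z s (pow z) k))

  Λ-D-decompose₁ : ∀ N c (w : Seq) x s →
    sum≤ N (λ k → c k * ((s ⊛ pow (x + w k)) (suc k) - w k * (s ⊛ pow (x + w k)) k))
      ≈ Λ N c (λ k → pow (x + w k)) (D s) + x * Λ N c (λ k → pow (x + w k)) s
  Λ-D-decompose₁ N c w x s = begin
    sum≤ N (λ k → c k * ((s ⊛ pow (x + w k)) (suc k) - w k * (s ⊛ pow (x + w k)) k))
      ≈⟨ sum≤-cong N (λ k → *-congˡ (trans (+-congʳ (⊛-pow-suc s (x + w k) k)) (pointwise _ _ (w k)))) ⟩
    sum≤ N (λ k → c k * (1# * (D s ⊛ pow (x + w k)) k + x * (s ⊛ pow (x + w k)) k))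
      ≈⟨ sum≤-lincomb N 1# x c _ _ ⟩
    1# * Λ N c (λ k → pow (x + w k)) (D s) + x * Λ N c (λ k → pow (x + w k)) s
      ≈⟨ +-congʳ (*-identityˡ _) ⟩
    Λ N c (λ k → pow (x + w k)) (D s) + x * Λ N c (λ k → pow (x + w k)) s ∎
    where
    pointwise : ∀ g f w → (g + (x + w) * f) - w * f ≈ 1# * g + x * f
    pointwise g f w = trans
      (+-congʳ (solve 4 (λ g f x w → g :+ (x :+ w) :* f := (con 1 :* g :+ x :* f) :+ w :* f) refl g f x w))
      (//-rightDividesʳ (w * f) _)

  Λ-D-decompose₂ : ∀ N c (w : Seq) α x s →
    sum≤ N (λ k → c k * ((α + 1#) * (s ⊛ pow (x + w k)) (suc k) - (x + (α + 1#) * w k) * (s ⊛ pow (x + w k)) k))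
      ≈ (α + 1#) * Λ N c (λ k → pow (x + w k)) (D s) + (α * x) * Λ N c (λ k → pow (x + w k)) s
  Λ-D-decompose₂ N c w α x s = trans
    (sum≤-cong N (λ k → *-congˡ (trans (+-congʳ (*-congˡ (⊛-pow-suc s (x + w k) k))) (pointwise _ _ (w k)))))
    (sum≤-lincomb N (α + 1#) (α * x) c _ _)
    where
    pointwise : ∀ g f w → (α + 1#) * (g + (x + w) * f) - (x + (α + 1#) * w) * f ≈ (α + 1#) * g + (α * x) * f
    pointwise g f w = trans
      (+-congʳ (solve 5 (λ a g x w f → (a :+ con 1) :* (g :+ (x :+ w) :* f)
                                      := ((a :+ con 1) :* g :+ (a :* x) :* f) :+ (x :+ (a :+ con 1) :* w) :* f)
                        refl α g x w f))
      (//-rightDividesʳ ((x + (α + 1#) * w) * f) _)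

  -- Powers of a series

  -- powCoeff a β is E β for L = logCoeff a.
  module ScaledExp (L : Seq) where
    E : Carrier → Seq
    E β = expCoeff (β · L)

    E-D : ∀ β → D (E β) ≐ β · (D L ⊛ E β)
    E-D β n = trans (expCoeff-D (β · L) n) (⊛-·ˡ β (D L) (E β) n)

    E-+ : ∀ {β γ ε} → β + γ ≈ ε → E β ⊛ E γ ≐ E ε
    E-+ {β} {γ} {ε} β+γ≈ε =
      ode-unique (ε · D L) (E β ⊛ E γ) (E ε)
        (trans (⊛-zero (E β) (E γ)) (*-identityˡ 1#)) derivative (expCoeff-D (ε · L))
      where
      derivative : D (E β ⊛ E γ) ≐ (ε · D L) ⊛ (E β ⊛ E γ)
      derivative n = begin
        (E β ⊛ E γ) (suc n)
          ≈⟨ ⊛-D (E β) (E γ) n ⟩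
        (D (E β) ⊛ E γ) n + (E β ⊛ D (E γ)) n
          ≈⟨ +-cong (⊛-congˡ (E γ) (E-D β) n) (⊛-congʳ (E β) (E-D γ) n) ⟩
        ((β · (D L ⊛ E β)) ⊛ E γ) n + (E β ⊛ (γ · (D L ⊛ E γ))) n
          ≈⟨ +-cong (trans (⊛-·ˡ β (D L ⊛ E β) (E γ) n) (*-congˡ (⊛-assoc (D L) (E β) (E γ) n)))
                    (trans (⊛-·ʳ γ (E β) (D L ⊛ E γ) n) (*-congˡ (⊛-rotate (E β) (D L) (E γ) n))) ⟩
        β * (D L ⊛ (E β ⊛ E γ)) n + γ * (D L ⊛ (E β ⊛ E γ)) n
          ≈⟨ distribʳ _ _ _ ⟨
        (β + γ) * (D L ⊛ (E β ⊛ E γ)) n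
          ≈⟨ *-congʳ β+γ≈ε ⟩
        ε * (D L ⊛ (E β ⊛ E γ)) n
          ≈⟨ ⊛-·ˡ ε (D L) (E β ⊛ E γ) n ⟨
        ((ε · D L) ⊛ (E β ⊛ E γ)) n ∎

    E-D-+ : ∀ {β γ ε} → β + γ ≈ ε → γ · D (E ε) ≐ E β ⊛ (ε · D (E γ))
    E-D-+ {β} {γ} {ε} β+γ≈ε n = begin
      γ * E ε (suc n)                       ≈⟨ *-congˡ (E-D ε n) ⟩
      γ * (ε * (D L ⊛ E ε) n)               ≈⟨ *-congˡ (*-congˡ (⊛-congʳ (D L) (E-+ β+γ≈ε) n)) ⟨
      γ * (ε * (D L ⊛ (E β ⊛ E γ)) n)       ≈⟨ *-congˡ (*-congˡ (⊛-rotate (D L) (E β) (E γ) n)) ⟩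
      γ * (ε * (E β ⊛ (D L ⊛ E γ)) n)
        ≈⟨ solve 3 (λ g e x → g :* (e :* x) := e :* (g :* x)) refl γ ε _ ⟩
      ε * (γ * (E β ⊛ (D L ⊛ E γ)) n)       ≈⟨ *-congˡ (⊛-·ʳ γ (E β) (D L ⊛ E γ) n) ⟨
      ε * (E β ⊛ (γ · (D L ⊛ E γ))) n       ≈⟨ *-congˡ (⊛-congʳ (E β) (E-D γ) n) ⟨
      ε * (E β ⊛ D (E γ)) n                 ≈⟨ ⊛-·ʳ ε (E β) (D (E γ)) n ⟨
      (E β ⊛ (ε · D (E γ))) n               ∎

    module Transfer N c d (w w′ : ℕ → Seq) (transfer : ∀ s → Λ N c w (E 1# ⊛ s) ≈ Λ N d w′ s) where
      transfer-E-pred : ∀ α → Λ N c w (E α) ≈ Λ N d w′ (E (α - 1#))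
      transfer-E-pred α = trans
        (Λ-cong N c w (λ k → sym (E-+ (trans (+-comm 1# (α - 1#)) (//-rightDividesˡ 1# α)) k)))
        (transfer (E (α - 1#)))

      transfer-E-suc : ∀ α → Λ N c w (E (α + 1#)) ≈ Λ N d w′ (E α)
      transfer-E-suc α = trans (Λ-cong N c w (λ k → sym (E-+ (+-comm 1# α) k))) (transfer (E α))

      transfer-D-E-suc : ∀ α → α * Λ N c w (D (E (α + 1#))) ≈ (α + 1#) * Λ N d w′ (D (E α))
      transfer-D-E-suc α = begin
        α * Λ N c w (D (E (α + 1#)))             ≈⟨ Λ-· N c w α _ ⟨
        Λ N c w (α · D (E (α + 1#)))             ≈⟨ Λ-cong N c w (E-D-+ (+-comm 1# α)) ⟩
        Λ N c w (E 1# ⊛ ((α + 1#) · D (E α)))    ≈⟨ transfer _ ⟩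
        Λ N d w′ ((α + 1#) · D (E α))            ≈⟨ Λ-· N d w′ (α + 1#) _ ⟩
        (α + 1#) * Λ N d w′ (D (E α))            ∎

proposition6 : ∀ {c ℓ : Level} (R : CommutativeRing c ℓ) →
    let open CommutativeRing R
        open Over R
    in Over.IsCharZeroField R →
       (a : ℕ → Carrier) → a 0 ≈ 1# →
       (n : ℕ) (u v : ℕ → Carrier) (U V : ℕ → ℕ → Carrier) →
       (∀ x → sum≤ n (λ k → U n k * fpoly a 1# k (x + u k))
              ≈ sum≤ n (λ k → V n k * pow (x + v k) k)) →
       ∀ α x →
         (sum≤ n (λ k → U n k * fpoly a α k (x + u k))
           ≈ sum≤ n (λ k → V n k * fpoly a (α - 1#) k (x + v k)))
         × (α * sum≤ n (λ k → U n k *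
                (fpoly a (α + 1#) (suc k) (x + u k)
                  - u k * fpoly a (α + 1#) k (x + u k)))
           ≈ sum≤ n (λ k → V n k *
                ((α + 1#) * fpoly a α (suc k) (x + v k)
                  - (x + (α + 1#) * v k) * fpoly a α k (x + v k))))
proposition6 R F a _ n u v U V hyp α x = transfer-E-pred α , second
  where
  open CommutativeRing R
  open Over R
  open EGF R
  open ScaledExp (logCoeff a)
  open import Relation.Binary.Reasoning.Setoid setoid

  wU wV : ℕ → Seq
  wU k = pow (x + u k)
  wV k = pow (x + v k)

  open Transfer n (U n) (V n) wU wV (Λ-transfer F n (U n) (V n) u v (E 1#) hyp x)

  second : α * sum≤ n (λ k → U n k * ((E (α + 1#) ⊛ wU k) (suc k) - u k * (E (α + 1#) ⊛ wU k) k))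
         ≈ sum≤ n (λ k → V n k * ((α + 1#) * (E α ⊛ wV k) (suc k) - (x + (α + 1#) * v k) * (E α ⊛ wV k) k))
  second = begin
    α * _
      ≈⟨ *-congˡ (Λ-D-decompose₁ n (U n) u x (E (α + 1#))) ⟩
    α * (Λ n (U n) wU (D (E (α + 1#))) + x * Λ n (U n) wU (E (α + 1#)))
      ≈⟨ trans (distribˡ _ _ _) (+-congˡ (sym (*-assoc _ _ _))) ⟩
    α * Λ n (U n) wU (D (E (α + 1#))) + (α * x) * Λ n (U n) wU (E (α + 1#))
      ≈⟨ +-cong (transfer-D-E-suc α) (*-congˡ (transfer-E-suc α)) ⟩
    (α + 1#) * Λ n (V n) wV (D (E α)) + (α * x) * Λ n (V n) wV (E α)
      ≈⟨ Λ-D-decompose₂ n (V n) v α x (E α) ⟨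
    _ ∎
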